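{- Let $n\ge1$, $\mu\in\mathbb{N}^n$, and let $\sigma:\mathrm{dg}'(\mu)\to[n]$ be any filling (not necessarily non-attacking). Then the number of inversion triples of $\widehat\sigma$ equals $\mathrm{inv}(\widehat\sigma)$, and the number of co-inversion triples of $\widehat\sigma$ equals $\mathrm{coinv}(\widehat\sigma)$.
   Context: For $\mu\in\mathbb{N}^n$, $\mathrm{dg}'(\mu)=\{(i,j)\in\mathbb{N}^2:1\le i\le n,\ 1\le j\le\mu_i\}$, $\widehat{\mathrm{dg}}(\mu)=\mathrm{dg}'(\mu)\cup\{(i,0):1\le i\le n\}$, $d((i,j))=(i,j-1)$. For $u=(i,j)\in\mathrm{dg}'(\mu)$: $l(u)=\mu_i-j$, $\mathrm{arm}(u)=\{(i',j)\in\mathrm{dg}'(\mu):i'<i,\ \mu_{i'}\le\mu_i\}\cup\{(i',j-1)\in\widehat{\mathrm{dg}}(\mu):i'>i,\ \mu_{i'}<\mu_i\}$ and $a(u)=|\mathrm{arm}(u)|$. Distinct boxes attack each other if in the same row, or of the form $(i,j),(i',j-1)$ with $i<i'$. Reading order: $(i,j)$ precedes $(i',j')$ iff $j>j'$, or $j=j'$ and $i>i'$. A filling $\sigma:\mathrm{dg}'(\mu)\to[n]$ has augmented filling $\widehat\sigma$ on $\widehat{\mathrm{dg}}(\mu)$ extending $\sigma$ with $\widehat\sigma((i,0))=i$. Descents: $u\in\mathrm{dg}'(\mu)$ with $\widehat\sigma(u)>\widehat\sigma(d(u))$, forming $\mathrm{Des}(\widehat\sigma)$. Inversions: pairs of attacking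 $u,v\in\widehat{\mathrm{dg}}(\mu)$ with $u$ preceding $v$ in reading order and $\widehat\sigma(u)>\widehat\sigma(v)$, forming $\mathrm{Inv}(\widehat\sigma)$. $\mathrm{inv}(\widehat\sigma)=|\mathrm{Inv}(\widehat\sigma)|-|\{(i,j):1\le i<j\le n,\ \mu_i\le\mu_j\}|-\sum_{u\in\mathrm{Des}(\widehat\sigma)}a(u)$ and $\mathrm{coinv}(\widehat\sigma)=\sum_{u\in\mathrm{dg}'(\mu)}a(u)-\mathrm{inv}(\widehat\sigma)$. A triple is $(u,v,w)$ with $u\in\mathrm{dg}'(\mu)$, $w=d(u)$, $v\in\mathrm{arm}(u)$ (then $u$ precedes $v$ and $v$ precedes $w$ in reading order). For boxes $x$ preceding $y$ in reading order let $\chi_{xy}(\widehat\sigma)=1$ if $\widehat\sigma(x)>\widehat\sigma(y)$ and $0$ otherwise. A triple is an inversion triple if $\chi_{uv}(\widehat\sigma)+\chi_{vw}(\widehat\sigma)-\chi_{uw}(\widehat\sigma)=1$, and a co-inversion triple otherwise. -}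

module Defs where

open import Data.Nat using (ℕ; zero; suc; _≤_; _<_; _≤?_; _<?_; pred)
open import Data.Nat.Properties using (_≟_)
open import Data.Fin using (Fin; toℕ; fromℕ<)
open import Data.List using (List; []; _∷_; length; filter; upTo; allFin; concatMap; map; cartesianProduct)
open import Data.Nat.ListAction using (sum)
open import Data.Bool using (Bool; true; false; _∧_; _∨_; not; if_then_else_)
open import Data.Product using (_×_; _,_; proj₁; proj₂)
open import Data.Integer using (ℤ; +_; _-_)
open import Relation.Nullary using (does; Dec; yes; no)
open import Relation.Unary using (Decidable)
open import Function using (_∘_)

-- A composition/weak composition μ ∈ ℕⁿ is a function Fin n → ℕ.
-- A box (i , j) ∈ ℕ² is represented with column index i : Fin n (1-based
-- index i corresponds to toℕ i + 1) and row index j : ℕ.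
Box : ℕ → Set
Box n = Fin n × ℕ

-- The box (i , j) of dg'(μ) with 1 ≤ j ≤ μ i
-- is given by the element k : Fin (μ i) with j = suc (toℕ k);
-- the value σ i k : Fin n stands for the label toℕ (σ i k) + 1 ∈ [n].
Filling : (n : ℕ) → (Fin n → ℕ) → Set
Filling n μ = (i : Fin n) → Fin (μ i) → Fin n

module _ {n : ℕ} (μ : Fin n → ℕ) where

  col : Box n → ℕ
  col = toℕ ∘ proj₁

  row : Box n → ℕ
  row = proj₂

  inDg' : Box n → Bool
  inDg' (i , zero) = false
  inDg' (i , suc j) = does (suc j ≤? μ i)

  inHat : Box n → Bool
  inHat (i , j) = does (j ≤? μ i)

  hatBoxes : List (Box n)
  hatBoxes = concatMap (λ i → map (λ j → (i , j)) (upTo (suc (μ i)))) (allFin n)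

  dgBoxes : List (Box n)
  dgBoxes = filter (λ b → inDg' b Data.Bool.≟ true) hatBoxes

  d : Box n → Box n
  d (i , j) = (i , pred j)

  eqN : ℕ → ℕ → Bool
  eqN a b = does (a ≟ b)

  ltN : ℕ → ℕ → Bool
  ltN a b = does (a <? b)

  leN : ℕ → ℕ → Bool
  leN a b = does (a ≤? b)

  inArm : Box n → Box n → Bool
  inArm (i , j) (i' , j') =
       (inDg' (i' , j') ∧ ltN (toℕ i') (toℕ i) ∧ eqN j' j ∧ leN (μ i') (μ i))
    ∨ (inHat (i' , j') ∧ ltN (toℕ i) (toℕ i') ∧ eqN (suc j') j ∧ ltN (μ i') (μ i))

  arm : Box n → List (Box n)
  arm u = filter (λ v → inArm u v Data.Bool.≟ true) hatBoxes

  a : Box n → ℕ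
  a u = length (arm u)

  sameBox : Box n → Box n → Bool
  sameBox u v = eqN (col u) (col v) ∧ eqN (row u) (row v)

  attacks : Box n → Box n → Bool
  attacks u v = not (sameBox u v) ∧
    (eqN (row u) (row v)
     ∨ (eqN (row u) (suc (row v)) ∧ ltN (col u) (col v))
     ∨ (eqN (row v) (suc (row u)) ∧ ltN (col v) (col u)))

  precedes : Box n → Box n → Bool
  precedes u v = ltN (row v) (row u) ∨ (eqN (row u) (row v) ∧ ltN (col v) (col u))

  module _ (σ : Filling n μ) where

    -- augmented filling σ̂, as a natural number (label minus one);
    -- σ̂ (i , 0) = i.  Values outside the augmented diagram are never used.
    σ̂ : Box n → ℕ
    σ̂ (i , zero) = toℕ i
    σ̂ (i , suc j) with suc j ≤? μ i
    ... | yes p = toℕ (σ i (fromℕ< p))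
    ... | no _  = 0

    isDes : Box n → Bool
    isDes u = ltN (σ̂ (d u)) (σ̂ u)

    Des : List (Box n)
    Des = filter (λ u → isDes u Data.Bool.≟ true) dgBoxes

    isInv : Box n × Box n → Bool
    isInv (u , v) = attacks u v ∧ precedes u v ∧ ltN (σ̂ v) (σ̂ u)

    Inv : List (Box n × Box n)
    Inv = filter (λ p → isInv p Data.Bool.≟ true) (cartesianProduct hatBoxes hatBoxes)

    weakPairs : List (Fin n × Fin n)
    weakPairs = filter (λ p → (ltN (toℕ (proj₁ p)) (toℕ (proj₂ p)) ∧ leN (μ (proj₁ p)) (μ (proj₂ p))) Data.Bool.≟ true)
                       (cartesianProduct (allFin n) (allFin n))

    inv : ℤ
    inv = (+ length Inv - + length weakPairs) - + sum (map a Des)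

    coinv : ℤ
    coinv = + sum (map a dgBoxes) - inv

    triples : List (Box n × Box n × Box n)
    triples = concatMap (λ u → map (λ v → (u , v , d u)) (arm u)) dgBoxes

    χ : Box n → Box n → ℕ
    χ x y = if ltN (σ̂ y) (σ̂ x) then 1 else 0

    isInvTriple : Box n × Box n × Box n → Bool
    isInvTriple (u , v , w) = eqN (χ u v Data.Nat.+ χ v w) (1 Data.Nat.+ χ u w)

    invTriples : List (Box n × Box n × Box n)
    invTriples = filter (λ t → isInvTriple t Data.Bool.≟ true) triples

    coinvTriples : List (Box n × Box n × Box n)
    coinvTriples = filter (λ t → not (isInvTriple t) Data.Bool.≟ true) triples

{-# OPTIONS --safe #-}
-- Call a pair (x, y) of boxes of the augmented diagram an attacking pair if x and y attack each
-- other and x precedes y in reading order.  Every triple (u, v, w) yields two attacking pairs, (u, v) and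
-- (v, w), and conversely every attacking pair arises in exactly one of three ways: as (u, v) with v ∈ arm(u);
-- as (v, w) for the triple whose top box u is the box directly above y; or as a pair ((i,0), (i',0)) of
-- row 0 with i' < i and μ_{i'} ≤ μ_i.  As σ̂(i,0) = i, the pairs of the last kind are all inversions, so
--   |Inv(σ̂)| = Σ_triples (χ_uv + χ_vw) + |{(i,j) : i < j, μ_i ≤ μ_j}|.
-- By transitivity of >, χ_uv + χ_vw − χ_uw is 0 or 1, hence it is the indicator of an inversion triple, while
-- Σ_triples χ_uw = Σ_{u ∈ Des(σ̂)} a(u).  Substituting gives inv(σ̂) = #inversion triples, and the statement
-- about co-inversion triples follows because there are Σ_u a(u) triples in all.
module Submission where

open import Defs
open import Data.Bool using (Bool; true; false; _∧_; _∨_; not; if_then_else_)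
import Data.Bool as Bool
open import Data.Bool.Properties using (∧-assoc)
open import Data.Fin using (Fin; toℕ)
open import Data.List using (List; []; _∷_; _++_; map; filter; concatMap; cartesianProduct; length; upTo; allFin)
open import Data.List.Properties using (map-++; map-cong; map-cong-local; map-∘; map-upTo; upTo-∷ʳ)
open import Data.List.Relation.Unary.All using (All)
open import Data.List.Relation.Unary.All.Properties using (concat⁺; map⁺; tabulate⁺; applyUpTo⁺₁)
open import Data.Nat using (ℕ; zero; suc; _+_; _*_; _≤_; _<_; z<s)
open import Data.Nat.ListAction using (sum)
open import Data.Nat.ListAction.Properties using (sum-++)
open import Data.Nat.Properties
open import Algebra.Properties.CommutativeSemigroup +-commutativeSemigroup using (interchange)
open import Data.Product using (_×_; _,_)
open import Data.Sum using (_⊎_; inj₁; inj₂)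
open import Function using (_∘_; id)
open import Relation.Binary.PropositionalEquality
open import Relation.Nullary using (¬_; does; proof; contradiction)
open import Relation.Nullary.Decidable using (dec-false)
open import Relation.Nullary.Reflects using (Reflects; ofʸ; ofⁿ; ¬-reflects; _×-reflects_; _⊎-reflects_)

𝟙 : Bool → ℕ
𝟙 b = if b then 1 else 0

𝟙-∧ : ∀ a b → 𝟙 (a ∧ b) ≡ 𝟙 a * 𝟙 b
𝟙-∧ true  b = sym (*-identityˡ (𝟙 b))
𝟙-∧ false b = refl

𝟙-not+𝟙 : ∀ b → 𝟙 (not b) + 𝟙 b ≡ 1
𝟙-not+𝟙 true  = refl
𝟙-not+𝟙 false = refl

𝟙-∨-disjoint : ∀ {A B : Set} {a b} → Reflects A a → Reflects B b → (A → ¬ B) →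
  𝟙 (a ∨ b) ≡ 𝟙 a + 𝟙 b
𝟙-∨-disjoint (ofʸ x) (ofʸ y) disjoint = contradiction y (disjoint x)
𝟙-∨-disjoint (ofʸ _) (ofⁿ _) _ = refl
𝟙-∨-disjoint (ofⁿ _) (ofʸ _) _ = refl
𝟙-∨-disjoint (ofⁿ _) (ofⁿ _) _ = refl

reflects-⇔-≡ : ∀ {A B : Set} {a b} → Reflects A a → Reflects B b → (A → B) → (B → A) → a ≡ b
reflects-⇔-≡ (ofʸ _) (ofʸ _) _ _ = refl
reflects-⇔-≡ (ofʸ x) (ofⁿ ¬y) to _ = contradiction (to x) ¬y
reflects-⇔-≡ (ofⁿ ¬x) (ofʸ y) _ from = contradiction (from y) ¬x
reflects-⇔-≡ (ofⁿ _) (ofⁿ _) _ _ = refl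

-- Sums over lists

module _ {A : Set} where

  ∑ : List A → (A → ℕ) → ℕ
  ∑ xs f = sum (map f xs)

  syntax ∑ xs (λ x → e) = ∑[ x ∈ xs ] e

  ∑-cong : ∀ xs {f g : A → ℕ} → (∀ x → f x ≡ g x) → ∑ xs f ≡ ∑ xs g
  ∑-cong xs f≗g = cong sum (map-cong f≗g xs)

  ∑-cong-All : ∀ {xs} {f g : A → ℕ} → All (λ x → f x ≡ g x) xs → ∑ xs f ≡ ∑ xs g
  ∑-cong-All eqs = cong sum (map-cong-local eqs)

  ∑-++ : ∀ xs ys (f : A → ℕ) → ∑ (xs ++ ys) f ≡ ∑ xs f + ∑ ys f
  ∑-++ xs ys f = trans (cong sum (map-++ f xs ys)) (sum-++ (map f xs) (map f ys))

  ∑-+ : ∀ xs (f g : A → ℕ) → ∑[ x ∈ xs ] (f x + g x) ≡ ∑ xs f + ∑ xs g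
  ∑-+ []       f g = refl
  ∑-+ (x ∷ xs) f g = trans (cong (f x + g x +_) (∑-+ xs f g)) (interchange (f x) (g x) _ _)

  ∑-*ˡ : ∀ xs c (f : A → ℕ) → ∑[ x ∈ xs ] (c * f x) ≡ c * ∑ xs f
  ∑-*ˡ []       c f = sym (*-zeroʳ c)
  ∑-*ˡ (x ∷ xs) c f = trans (cong (c * f x +_) (∑-*ˡ xs c f)) (sym (*-distribˡ-+ c (f x) _))

  ∑-const : ∀ xs k → ∑[ _ ∈ xs ] k ≡ length xs * k
  ∑-const []       k = refl
  ∑-const (x ∷ xs) k = cong (k +_) (∑-const xs k)

  ∑-zero : ∀ xs → ∑[ _ ∈ xs ] 0 ≡ 0
  ∑-zero xs = trans (∑-const xs 0) (*-zeroʳ (length xs))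

  ∑-filter : ∀ (p : A → Bool) xs f →
    ∑ (filter (λ x → p x Bool.≟ true) xs) f ≡ ∑[ x ∈ xs ] (𝟙 (p x) * f x)
  ∑-filter p []       f = refl
  ∑-filter p (x ∷ xs) f with p x
  ... | true  = cong₂ _+_ (sym (+-identityʳ (f x))) (∑-filter p xs f)
  ... | false = ∑-filter p xs f

  length-filter : ∀ (p : A → Bool) xs →
    length (filter (λ x → p x Bool.≟ true) xs) ≡ ∑[ x ∈ xs ] 𝟙 (p x)
  length-filter p []       = refl
  length-filter p (x ∷ xs) with p x
  ... | true  = cong suc (length-filter p xs)
  ... | false = length-filter p xs

∑-map : ∀ {A B : Set} (h : A → B) xs f → ∑ (map h xs) f ≡ ∑ xs (f ∘ h)
∑-map h xs f = cong sum (sym (map-∘ xs))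

∑-concatMap : ∀ {A B : Set} (g : A → List B) xs f → ∑ (concatMap g xs) f ≡ ∑[ x ∈ xs ] ∑ (g x) f
∑-concatMap g []       f = refl
∑-concatMap g (x ∷ xs) f = trans (∑-++ (g x) _ f) (cong (∑ (g x) f +_) (∑-concatMap g xs f))

∑-comm : ∀ {A B : Set} xs ys (f : A → B → ℕ) →
  ∑[ x ∈ xs ] ∑[ y ∈ ys ] f x y ≡ ∑[ y ∈ ys ] ∑[ x ∈ xs ] f x y
∑-comm []       ys f = sym (∑-zero ys)
∑-comm (x ∷ xs) ys f =
  trans (cong (∑ ys (f x) +_) (∑-comm xs ys f)) (sym (∑-+ ys (f x) λ y → ∑[ x ∈ xs ] f x y))

∑-cartesianProduct : ∀ {A B : Set} xs ys (f : A × B → ℕ) →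
  ∑ (cartesianProduct xs ys) f ≡ ∑[ x ∈ xs ] ∑[ y ∈ ys ] f (x , y)
∑-cartesianProduct []       ys f = refl
∑-cartesianProduct (x ∷ xs) ys f =
  trans (∑-++ (map (x ,_) ys) _ f) (cong₂ _+_ (∑-map (x ,_) ys f) (∑-cartesianProduct xs ys f))

∑-upTo-suc : ∀ m (f : ℕ → ℕ) → ∑ (upTo (suc m)) f ≡ f 0 + ∑ (upTo m) (f ∘ suc)
∑-upTo-suc m f =
  cong (f 0 +_) (trans (cong (λ js → ∑ js f) (sym (map-upTo suc m))) (∑-map suc (upTo m) f))

∑-upTo-∷ʳ : ∀ m (f : ℕ → ℕ) → ∑ (upTo (suc m)) f ≡ ∑ (upTo m) f + f m
∑-upTo-∷ʳ m f = begin
  ∑ (upTo (suc m)) f        ≡⟨ cong (λ js → ∑ js f) (sym (upTo-∷ʳ m)) ⟩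
  ∑ (upTo m ++ m ∷ []) f    ≡⟨ ∑-++ (upTo m) _ f ⟩
  ∑ (upTo m) f + (f m + 0)  ≡⟨ cong (∑ (upTo m) f +_) (+-identityʳ (f m)) ⟩
  ∑ (upTo m) f + f m        ∎
  where open ≡-Reasoning

∑-upTo-shift : ∀ m (f : ℕ → ℕ) → f 0 ≡ 0 → f (suc m) ≡ 0 →
  ∑ (upTo (suc m)) f ≡ ∑ (upTo (suc m)) (f ∘ suc)
∑-upTo-shift m f f0≡0 fm≡0 = begin
  ∑ (upTo (suc m)) f                    ≡⟨ ∑-upTo-suc m f ⟩
  f 0 + ∑ (upTo m) (f ∘ suc)            ≡⟨ cong (_+ ∑ (upTo m) (f ∘ suc)) f0≡0 ⟩
  ∑ (upTo m) (f ∘ suc)                  ≡⟨ sym (+-identityʳ _) ⟩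
  ∑ (upTo m) (f ∘ suc) + 0              ≡⟨ cong (∑ (upTo m) (f ∘ suc) +_) (sym fm≡0) ⟩
  ∑ (upTo m) (f ∘ suc) + f (suc m)      ≡⟨ sym (∑-upTo-∷ʳ m (f ∘ suc)) ⟩
  ∑ (upTo (suc m)) (f ∘ suc)            ∎
  where open ≡-Reasoning

∑-upTo-head : ∀ m (f : ℕ → ℕ) → (∀ j → f (suc j) ≡ 0) → ∑ (upTo (suc m)) f ≡ f 0
∑-upTo-head m f vanish = begin
  ∑ (upTo (suc m)) f                ≡⟨ ∑-upTo-suc m f ⟩
  f 0 + ∑ (upTo m) (f ∘ suc)        ≡⟨ cong (f 0 +_) (∑-cong (upTo m) vanish) ⟩
  f 0 + ∑[ _ ∈ upTo m ] 0           ≡⟨ cong (f 0 +_) (∑-zero (upTo m)) ⟩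
  f 0 + 0                           ≡⟨ +-identityʳ (f 0) ⟩
  f 0                               ∎
  where open ≡-Reasoning

-- The augmented diagram and its attacking pairs

up : ∀ {n} → Box n → Box n
up (i , j) = (i , suc j)

module _ {n : ℕ} (μ : Fin n → ℕ) where

  ∑-hatBoxes : ∀ f → ∑ (hatBoxes μ) f ≡ ∑[ i ∈ allFin n ] ∑[ j ∈ upTo (suc (μ i)) ] f (i , j)
  ∑-hatBoxes f =
    trans (∑-concatMap _ (allFin n) f) (∑-cong (allFin n) λ i → ∑-map (i ,_) (upTo (suc (μ i))) f)

  hatBoxes-All : ∀ {P : Box n → Set} → (∀ i j → j ≤ μ i → P (i , j)) → All P (hatBoxes μ)
  hatBoxes-All P-hat =
    concat⁺ (map⁺ (tabulate⁺ λ i →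
      map⁺ (applyUpTo⁺₁ id (suc (μ i)) λ j<1+μi → P-hat i _ (≤-pred j<1+μi))))

  ∑-hatBoxes-rowZero : ∀ f → (∀ i j → f (i , suc j) ≡ 0) →
    ∑ (hatBoxes μ) f ≡ ∑[ i ∈ allFin n ] f (i , 0)
  ∑-hatBoxes-rowZero f vanish =
    trans (∑-hatBoxes f) (∑-cong (allFin n) λ i → ∑-upTo-head (μ i) (λ j → f (i , j)) (vanish i))

  ∑-hatBoxes-up : ∀ f → (∀ i → f (i , 0) ≡ 0) → (∀ i → f (i , suc (μ i)) ≡ 0) →
    ∑ (hatBoxes μ) f ≡ ∑ (hatBoxes μ) (f ∘ up)
  ∑-hatBoxes-up f bottom top = begin
    ∑ (hatBoxes μ) f                                              ≡⟨ ∑-hatBoxes f ⟩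
    ∑[ i ∈ allFin n ] ∑[ j ∈ upTo (suc (μ i)) ] f (i , j)         ≡⟨ ∑-cong (allFin n) shift ⟩
    ∑[ i ∈ allFin n ] ∑[ j ∈ upTo (suc (μ i)) ] f (i , suc j)     ≡⟨ sym (∑-hatBoxes (f ∘ up)) ⟩
    ∑ (hatBoxes μ) (f ∘ up)                                       ∎
    where
    open ≡-Reasoning
    shift : ∀ i → ∑[ j ∈ upTo (suc (μ i)) ] f (i , j) ≡ ∑[ j ∈ upTo (suc (μ i)) ] f (i , suc j)
    shift i = ∑-upTo-shift (μ i) (λ j → f (i , j)) (bottom i) (top i)

  isArmPair : Box n → Box n → Bool
  isArmPair u v = inDg' μ u ∧ inArm μ u v

  isWeakBasePair : Box n → Box n → Bool
  isWeakBasePair (i , zero) (i' , zero) = ltN μ (toℕ i') (toℕ i) ∧ leN μ (μ i') (μ i)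
  isWeakBasePair _          _           = false

  -- Literal transcriptions of the Boolean predicates above and in Defs, so that each is reflected by its Boolean.
  InDg' : Box n → Set
  InDg' (i , j) = 0 < j × j ≤ μ i

  InArm : Box n → Box n → Set
  InArm (i , j) (i' , j') =
      InDg' (i' , j') × toℕ i' < toℕ i × j' ≡ j × μ i' ≤ μ i
    ⊎ j' ≤ μ i' × toℕ i < toℕ i' × suc j' ≡ j × μ i' < μ i

  ArmPair : Box n → Box n → Set
  ArmPair u v = InDg' u × InArm u v

  WeakBasePair : Box n → Box n → Set
  WeakBasePair (i , j) (i' , j') = j ≡ 0 × j' ≡ 0 × toℕ i' < toℕ i × μ i' ≤ μ i

  Attacks : Box n → Box n → Set
  Attacks (i , j) (i' , j') =
    ¬ (toℕ i ≡ toℕ i' × j ≡ j') ×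
    (j ≡ j' ⊎ j ≡ suc j' × toℕ i < toℕ i' ⊎ j' ≡ suc j × toℕ i' < toℕ i)

  Precedes : Box n → Box n → Set
  Precedes (i , j) (i' , j') = j' < j ⊎ j ≡ j' × toℕ i' < toℕ i

  inDg'-reflects : ∀ u → Reflects (InDg' u) (inDg' μ u)
  inDg'-reflects (i , zero)  = ofⁿ λ ()
  inDg'-reflects (i , suc j) = ofʸ z<s ×-reflects proof (suc j ≤? μ i)

  inArm-reflects : ∀ u v → Reflects (InArm u v) (inArm μ u v)
  inArm-reflects (i , j) (i' , j') =
      inDg'-reflects (i' , j') ×-reflects proof (toℕ i' <? toℕ i)
        ×-reflects proof (j' ≟ j) ×-reflects proof (μ i' ≤? μ i)
    ⊎-reflects proof (j' ≤? μ i') ×-reflects proof (toℕ i <? toℕ i')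
        ×-reflects proof (suc j' ≟ j) ×-reflects proof (μ i' <? μ i)

  isArmPair-reflects : ∀ u v → Reflects (ArmPair u v) (isArmPair u v)
  isArmPair-reflects u v = inDg'-reflects u ×-reflects inArm-reflects u v

  isWeakBasePair-reflects : ∀ u v → Reflects (WeakBasePair u v) (isWeakBasePair u v)
  isWeakBasePair-reflects (i , zero) (i' , zero) =
    ofʸ refl ×-reflects ofʸ refl ×-reflects proof (toℕ i' <? toℕ i) ×-reflects proof (μ i' ≤? μ i)
  isWeakBasePair-reflects (i , zero)  (i' , suc j') = ofⁿ λ ()
  isWeakBasePair-reflects (i , suc j) (i' , j')     = ofⁿ λ ()

  attacksBefore-reflects : ∀ u v → Reflects (Attacks u v × Precedes u v) (attacks μ u v ∧ precedes μ u v)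
  attacksBefore-reflects (i , j) (i' , j') =
    (¬-reflects (proof (toℕ i ≟ toℕ i') ×-reflects proof (j ≟ j')) ×-reflects
      (proof (j ≟ j') ⊎-reflects proof (j ≟ suc j') ×-reflects proof (toℕ i <? toℕ i')
                      ⊎-reflects proof (j' ≟ suc j) ×-reflects proof (toℕ i' <? toℕ i)))
    ×-reflects (proof (j' <? j) ⊎-reflects proof (j ≟ j') ×-reflects proof (toℕ i' <? toℕ i))

  sameRow⇒split : ∀ {i i' j} → j ≤ μ i → j ≤ μ i' → toℕ i' < toℕ i →
    ArmPair (i , j) (i' , j) ⊎ ArmPair (i' , suc j) (i , j) ⊎ WeakBasePair (i , j) (i' , j)
  sameRow⇒split {i} {i'} {j} hj hj' i'<i with ≤-<-connex (μ i') (μ i) | j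
  ... | inj₁ μi'≤μi | zero  = inj₂ (inj₂ (refl , refl , i'<i , μi'≤μi))
  ... | inj₁ μi'≤μi | suc _ = inj₁ ((z<s , hj) , inj₁ ((z<s , hj') , i'<i , refl , μi'≤μi))
  ... | inj₂ μi<μi' | _     = inj₂ (inj₁ ((z<s , ≤-<-trans hj μi<μi') , inj₂ (hj , i'<i , refl , μi<μi')))

  stepDown⇒split : ∀ {i i' j'} → suc j' ≤ μ i → j' ≤ μ i' → toℕ i < toℕ i' →
    ArmPair (i , suc j') (i' , j') ⊎ ArmPair (i' , suc j') (i , suc j') ⊎ WeakBasePair (i , suc j') (i' , j')
  stepDown⇒split {i} {i'} hj hj' i<i' with <-≤-connex (μ i') (μ i)
  ... | inj₁ μi'<μi = inj₁ ((z<s , hj) , inj₂ (hj' , i<i' , refl , μi'<μi))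
  ... | inj₂ μi≤μi' = inj₂ (inj₁ ((z<s , ≤-trans hj μi≤μi') , inj₁ ((z<s , hj) , i<i' , refl , μi≤μi')))

  sameRow⇒attacksBefore : ∀ {i i' j} → toℕ i' < toℕ i →
    Attacks (i , j) (i' , j) × Precedes (i , j) (i' , j)
  sameRow⇒attacksBefore i'<i =
    ((λ (i≡i' , _) → <-irrefl (sym i≡i') i'<i) , inj₁ refl) , inj₂ (refl , i'<i)

  stepDown⇒attacksBefore : ∀ {i i' j'} → toℕ i < toℕ i' →
    Attacks (i , suc j') (i' , j') × Precedes (i , suc j') (i' , j')
  stepDown⇒attacksBefore {j' = j'} i<i' =
    ((λ (i≡i' , _) → <-irrefl i≡i' i<i') , inj₂ (inj₁ (refl , i<i'))) , inj₁ (n<1+n j')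

  attacksBefore⇒split : ∀ {i i' j j'} → j ≤ μ i → j' ≤ μ i' →
    Attacks (i , j) (i' , j') × Precedes (i , j) (i' , j') →
    ArmPair (i , j) (i' , j') ⊎ ArmPair (i' , suc j') (i , j) ⊎ WeakBasePair (i , j) (i' , j')
  attacksBefore⇒split {j = j} _ _ ((_ , inj₁ refl) , inj₁ j<j)           = contradiction j<j (n≮n j)
  attacksBefore⇒split hj hj' ((_ , inj₁ refl) , inj₂ (_ , i'<i))         = sameRow⇒split hj hj' i'<i
  attacksBefore⇒split hj hj' ((_ , inj₂ (inj₁ (refl , i<i'))) , _)       = stepDown⇒split hj hj' i<i'
  attacksBefore⇒split {j = j} _ _ ((_ , inj₂ (inj₂ (refl , _))) , inj₁ 1+j<j) =
    contradiction 1+j<j (<-asym (n<1+n j))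
  attacksBefore⇒split _ _ ((_ , inj₂ (inj₂ (refl , _))) , inj₂ (j≡1+j , _)) =
    contradiction (sym j≡1+j) 1+n≢n

  split⇒attacksBefore : ∀ {i i' j j'} →
    ArmPair (i , j) (i' , j') ⊎ ArmPair (i' , suc j') (i , j) ⊎ WeakBasePair (i , j) (i' , j') →
    Attacks (i , j) (i' , j') × Precedes (i , j) (i' , j')
  split⇒attacksBefore (inj₁ (_ , inj₁ (_ , i'<i , refl , _)))         = sameRow⇒attacksBefore i'<i
  split⇒attacksBefore (inj₁ (_ , inj₂ (_ , i<i' , refl , _)))         = stepDown⇒attacksBefore i<i'
  split⇒attacksBefore (inj₂ (inj₁ (_ , inj₁ (_ , i<i' , refl , _)))) = stepDown⇒attacksBefore i<i'
  split⇒attacksBefore (inj₂ (inj₁ (_ , inj₂ (_ , i'<i , refl , _)))) = sameRow⇒attacksBefore i'<i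
  split⇒attacksBefore (inj₂ (inj₂ (refl , refl , i'<i , _)))          = sameRow⇒attacksBefore i'<i

  armPair-disjoint : ∀ {i i' j j'} → ArmPair (i , j) (i' , j') →
    ¬ (ArmPair (i' , suc j') (i , j) ⊎ WeakBasePair (i , j) (i' , j'))
  armPair-disjoint (_ , inj₁ (_ , i'<i , _ , _)) (inj₁ (_ , inj₁ (_ , i<i' , _ , _)))   = <-asym i'<i i<i'
  armPair-disjoint (_ , inj₁ (_ , _ , _ , μi'≤μi)) (inj₁ (_ , inj₂ (_ , _ , _ , μi<μi'))) = <⇒≱ μi<μi' μi'≤μi
  armPair-disjoint (_ , inj₂ (_ , _ , _ , μi'<μi)) (inj₁ (_ , inj₁ (_ , _ , _ , μi≤μi'))) = <⇒≱ μi'<μi μi≤μi'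
  armPair-disjoint (_ , inj₂ (_ , i<i' , _ , _)) (inj₁ (_ , inj₂ (_ , i'<i , _ , _)))   = <-asym i<i' i'<i
  armPair-disjoint ((() , _) , _) (inj₂ (refl , _))

  upArmPair-disjoint : ∀ {i i' j j'} → ArmPair (i' , suc j') (i , j) → ¬ WeakBasePair (i , j) (i' , j')
  upArmPair-disjoint (_ , inj₁ (_ , _ , j≡1+j' , _)) (j≡0 , _) = 1+n≢0 (trans (sym j≡1+j') j≡0)
  upArmPair-disjoint (_ , inj₂ (_ , _ , _ , μi<μi')) (_ , _ , _ , μi'≤μi) = <⇒≱ μi<μi' μi'≤μi

  𝟙-attacksBefore : ∀ {i i' j j'} → j ≤ μ i → j' ≤ μ i' →
    let x = (i , j); y = (i' , j') in
    𝟙 (attacks μ x y ∧ precedes μ x y)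
      ≡ 𝟙 (isArmPair x y) + (𝟙 (isArmPair (up y) x) + 𝟙 (isWeakBasePair x y))
  𝟙-attacksBefore {i} {i'} {j} {j'} hj hj' = begin
    𝟙 (attacks μ x y ∧ precedes μ x y)
      ≡⟨ cong 𝟙 (reflects-⇔-≡ (attacksBefore-reflects x y) (armPair ⊎-reflects upArmPair ⊎-reflects weak)
                               (attacksBefore⇒split hj hj') split⇒attacksBefore) ⟩
    𝟙 (isArmPair x y ∨ isArmPair (up y) x ∨ isWeakBasePair x y)
      ≡⟨ 𝟙-∨-disjoint armPair (upArmPair ⊎-reflects weak) armPair-disjoint ⟩
    𝟙 (isArmPair x y) + 𝟙 (isArmPair (up y) x ∨ isWeakBasePair x y)
      ≡⟨ cong (𝟙 (isArmPair x y) +_) (𝟙-∨-disjoint upArmPair weak upArmPair-disjoint) ⟩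
    𝟙 (isArmPair x y) + (𝟙 (isArmPair (up y) x) + 𝟙 (isWeakBasePair x y)) ∎
    where
    open ≡-Reasoning
    x = (i , j)
    y = (i' , j')
    armPair = isArmPair-reflects x y
    upArmPair = isArmPair-reflects (up y) x
    weak = isWeakBasePair-reflects x y

  inDg'-aboveColumn : ∀ i → inDg' μ (i , suc (μ i)) ≡ false
  inDg'-aboveColumn i = dec-false (suc (μ i) ≤? μ i) 1+n≰n

  ∑-armPairs : ∀ (g : Box n → Box n → ℕ) →
    ∑[ u ∈ dgBoxes μ ] ∑[ v ∈ arm μ u ] g u v
      ≡ ∑[ u ∈ hatBoxes μ ] ∑[ v ∈ hatBoxes μ ] (𝟙 (isArmPair u v) * g u v)
  ∑-armPairs g = trans (∑-filter (inDg' μ) (hatBoxes μ) _) (∑-cong (hatBoxes μ) λ u → begin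
    𝟙 (inDg' μ u) * ∑[ v ∈ arm μ u ] g u v
      ≡⟨ cong (𝟙 (inDg' μ u) *_) (∑-filter (inArm μ u) (hatBoxes μ) (g u)) ⟩
    𝟙 (inDg' μ u) * ∑[ v ∈ hatBoxes μ ] (𝟙 (inArm μ u v) * g u v)
      ≡⟨ sym (∑-*ˡ (hatBoxes μ) (𝟙 (inDg' μ u)) _) ⟩
    ∑[ v ∈ hatBoxes μ ] (𝟙 (inDg' μ u) * (𝟙 (inArm μ u v) * g u v))
      ≡⟨ ∑-cong (hatBoxes μ) (λ v → trans (sym (*-assoc (𝟙 (inDg' μ u)) _ _))
                                          (cong (_* g u v) (sym (𝟙-∧ (inDg' μ u) (inArm μ u v))))) ⟩
    ∑[ v ∈ hatBoxes μ ] (𝟙 (isArmPair u v) * g u v) ∎)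
    where open ≡-Reasoning

-- Counting inversions through triples

inversion-triangle : ∀ {p q r a b c} → Reflects (q < p) a → Reflects (r < q) b → Reflects (r < p) c →
  𝟙 (does (𝟙 a + 𝟙 b ≟ 1 + 𝟙 c)) + 𝟙 c ≡ 𝟙 a + 𝟙 b
inversion-triangle (ofʸ _)   (ofʸ _)   (ofʸ _)   = refl
inversion-triangle (ofʸ q<p) (ofʸ r<q) (ofⁿ r≮p) = contradiction (<-trans r<q q<p) r≮p
inversion-triangle (ofʸ _)   (ofⁿ _)   (ofʸ _)   = refl
inversion-triangle (ofʸ _)   (ofⁿ _)   (ofⁿ _)   = refl
inversion-triangle (ofⁿ _)   (ofʸ _)   (ofʸ _)   = refl
inversion-triangle (ofⁿ _)   (ofʸ _)   (ofⁿ _)   = refl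
inversion-triangle (ofⁿ q≮p) (ofⁿ r≮q) (ofʸ r<p) = contradiction (≤-trans (≮⇒≥ q≮p) (≮⇒≥ r≮q)) (<⇒≱ r<p)
inversion-triangle (ofⁿ _)   (ofⁿ _)   (ofⁿ _)   = refl

module _ {n : ℕ} (μ : Fin n → ℕ) (σ : Filling n μ) where

  ∑-triples : ∀ f → ∑ (triples μ σ) f ≡ ∑[ u ∈ dgBoxes μ ] ∑[ v ∈ arm μ u ] f (u , v , d μ u)
  ∑-triples f = trans (∑-concatMap _ (dgBoxes μ) f)
                      (∑-cong (dgBoxes μ) λ u → ∑-map (λ v → (u , v , d μ u)) (arm μ u) f)

  ∑-triples-χ-uv : ∑ (triples μ σ) (λ (u , v , _) → χ μ σ u v)
                 ≡ ∑[ x ∈ hatBoxes μ ] ∑[ y ∈ hatBoxes μ ] (𝟙 (isArmPair μ x y) * χ μ σ x y)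
  ∑-triples-χ-uv = trans (∑-triples _) (∑-armPairs μ (χ μ σ))

  ∑-triples-χ-vw : ∑ (triples μ σ) (λ (_ , v , w) → χ μ σ v w)
                 ≡ ∑[ x ∈ hatBoxes μ ] ∑[ y ∈ hatBoxes μ ] (𝟙 (isArmPair μ (up y) x) * χ μ σ x y)
  ∑-triples-χ-vw = begin
    ∑ (triples μ σ) (λ (_ , v , w) → χ μ σ v w)
      ≡⟨ trans (∑-triples _) (∑-armPairs μ λ u v → χ μ σ v (d μ u)) ⟩
    ∑[ u ∈ hatBoxes μ ] ∑[ v ∈ hatBoxes μ ] (𝟙 (isArmPair μ u v) * χ μ σ v (d μ u))
      ≡⟨ ∑-comm (hatBoxes μ) (hatBoxes μ) _ ⟩
    ∑[ v ∈ hatBoxes μ ] ∑[ u ∈ hatBoxes μ ] (𝟙 (isArmPair μ u v) * χ μ σ v (d μ u))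
      ≡⟨ ∑-cong (hatBoxes μ) (λ v → ∑-hatBoxes-up μ _ (λ _ → refl) (top v)) ⟩
    ∑[ v ∈ hatBoxes μ ] ∑[ y ∈ hatBoxes μ ] (𝟙 (isArmPair μ (up y) v) * χ μ σ v y) ∎
    where
    open ≡-Reasoning
    top : ∀ v i → 𝟙 (isArmPair μ (i , suc (μ i)) v) * χ μ σ v (i , μ i) ≡ 0
    top v i =
      cong (λ b → 𝟙 (b ∧ inArm μ (i , suc (μ i)) v) * χ μ σ v (i , μ i)) (inDg'-aboveColumn μ i)

  ∑-triples-χ-uw : ∑ (triples μ σ) (λ (u , _ , w) → χ μ σ u w) ≡ sum (map (a μ) (Des μ σ))
  ∑-triples-χ-uw = begin
    ∑ (triples μ σ) (λ (u , _ , w) → χ μ σ u w)         ≡⟨ ∑-triples _ ⟩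
    ∑[ u ∈ dgBoxes μ ] ∑[ _ ∈ arm μ u ] χ μ σ u (d μ u) ≡⟨ ∑-cong (dgBoxes μ) descents ⟩
    ∑[ u ∈ dgBoxes μ ] (𝟙 (isDes μ σ u) * a μ u)        ≡⟨ sym (∑-filter (isDes μ σ) (dgBoxes μ) (a μ)) ⟩
    sum (map (a μ) (Des μ σ))                           ∎
    where
    open ≡-Reasoning
    descents : ∀ u → ∑[ _ ∈ arm μ u ] χ μ σ u (d μ u) ≡ 𝟙 (isDes μ σ u) * a μ u
    descents u = trans (∑-const (arm μ u) _) (*-comm (a μ u) _)

  weakBasePair-*χ : ∀ x y → 𝟙 (isWeakBasePair μ x y) * χ μ σ x y ≡ 𝟙 (isWeakBasePair μ x y)
  weakBasePair-*χ (i , zero) (i' , zero) with ltN μ (toℕ i') (toℕ i)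
  ... | true  = *-identityʳ _
  ... | false = refl
  weakBasePair-*χ (i , zero)  (i' , suc j') = refl
  weakBasePair-*χ (i , suc j) y             = refl

  𝟙-isInv : ∀ {i i' j j'} → j ≤ μ i → j' ≤ μ i' → let x = (i , j); y = (i' , j') in
    𝟙 (isInv μ σ (x , y))
      ≡ 𝟙 (isArmPair μ x y) * χ μ σ x y
        + (𝟙 (isArmPair μ (up y) x) * χ μ σ x y + 𝟙 (isWeakBasePair μ x y))
  𝟙-isInv {i} {i'} {j} {j'} hj hj' = begin
    𝟙 (attacks μ x y ∧ precedes μ x y ∧ c)
      ≡⟨ cong 𝟙 (sym (∧-assoc (attacks μ x y) _ c)) ⟩
    𝟙 ((attacks μ x y ∧ precedes μ x y) ∧ c)
      ≡⟨ 𝟙-∧ (attacks μ x y ∧ precedes μ x y) c ⟩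
    𝟙 (attacks μ x y ∧ precedes μ x y) * 𝟙 c
      ≡⟨ cong (_* 𝟙 c) (𝟙-attacksBefore μ hj hj') ⟩
    (𝟙 (isArmPair μ x y) + (𝟙 (isArmPair μ (up y) x) + 𝟙 (isWeakBasePair μ x y))) * 𝟙 c
      ≡⟨ *-distribʳ-+ (𝟙 c) (𝟙 (isArmPair μ x y)) _ ⟩
    𝟙 (isArmPair μ x y) * 𝟙 c + (𝟙 (isArmPair μ (up y) x) + 𝟙 (isWeakBasePair μ x y)) * 𝟙 c
      ≡⟨ cong (𝟙 (isArmPair μ x y) * 𝟙 c +_) (*-distribʳ-+ (𝟙 c) (𝟙 (isArmPair μ (up y) x)) _) ⟩
    𝟙 (isArmPair μ x y) * 𝟙 c + (𝟙 (isArmPair μ (up y) x) * 𝟙 c + 𝟙 (isWeakBasePair μ x y) * 𝟙 c)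
      ≡⟨ cong (λ w → 𝟙 (isArmPair μ x y) * 𝟙 c + (𝟙 (isArmPair μ (up y) x) * 𝟙 c + w))
              (weakBasePair-*χ x y) ⟩
    𝟙 (isArmPair μ x y) * 𝟙 c + (𝟙 (isArmPair μ (up y) x) * 𝟙 c + 𝟙 (isWeakBasePair μ x y)) ∎
    where
    open ≡-Reasoning
    x = (i , j)
    y = (i' , j')
    c = ltN μ (σ̂ μ σ y) (σ̂ μ σ x)

  ∑-weakBasePairs :
    ∑[ x ∈ hatBoxes μ ] ∑[ y ∈ hatBoxes μ ] 𝟙 (isWeakBasePair μ x y) ≡ length (weakPairs μ σ)
  ∑-weakBasePairs = begin
    ∑[ x ∈ hatBoxes μ ] ∑[ y ∈ hatBoxes μ ] 𝟙 (isWeakBasePair μ x y)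
      ≡⟨ ∑-hatBoxes-rowZero μ _ (λ _ _ → ∑-zero (hatBoxes μ)) ⟩
    ∑[ i ∈ allFin n ] ∑[ y ∈ hatBoxes μ ] 𝟙 (isWeakBasePair μ (i , 0) y)
      ≡⟨ ∑-cong (allFin n) (λ i → ∑-hatBoxes-rowZero μ _ λ _ _ → refl) ⟩
    ∑[ i ∈ allFin n ] ∑[ i' ∈ allFin n ] 𝟙 (ltN μ (toℕ i') (toℕ i) ∧ leN μ (μ i') (μ i))
      ≡⟨ ∑-comm (allFin n) (allFin n) _ ⟩
    ∑[ p ∈ allFin n ] ∑[ q ∈ allFin n ] 𝟙 (ltN μ (toℕ p) (toℕ q) ∧ leN μ (μ p) (μ q))
      ≡⟨ sym (trans (length-filter _ (cartesianProduct (allFin n) (allFin n)))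
                    (∑-cartesianProduct (allFin n) (allFin n) _)) ⟩
    length (weakPairs μ σ) ∎
    where open ≡-Reasoning

  ∑-triples-inversionTriangle :
    length (invTriples μ σ) + ∑ (triples μ σ) (λ (u , _ , w) → χ μ σ u w)
      ≡ ∑ (triples μ σ) (λ (u , v , _) → χ μ σ u v) + ∑ (triples μ σ) (λ (_ , v , w) → χ μ σ v w)
  ∑-triples-inversionTriangle = begin
    length (invTriples μ σ) + ∑ (triples μ σ) (λ (u , _ , w) → χ μ σ u w)
      ≡⟨ cong (_+ ∑ (triples μ σ) (λ (u , _ , w) → χ μ σ u w))
              (length-filter (isInvTriple μ σ) (triples μ σ)) ⟩
    ∑ (triples μ σ) (𝟙 ∘ isInvTriple μ σ) + ∑ (triples μ σ) (λ (u , _ , w) → χ μ σ u w)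
      ≡⟨ sym (∑-+ (triples μ σ) _ _) ⟩
    ∑ (triples μ σ) (λ (u , v , w) → 𝟙 (isInvTriple μ σ (u , v , w)) + χ μ σ u w)
      ≡⟨ ∑-cong (triples μ σ) triangle ⟩
    ∑ (triples μ σ) (λ (u , v , w) → χ μ σ u v + χ μ σ v w)
      ≡⟨ ∑-+ (triples μ σ) _ _ ⟩
    ∑ (triples μ σ) (λ (u , v , _) → χ μ σ u v) + ∑ (triples μ σ) (λ (_ , v , w) → χ μ σ v w) ∎
    where
    open ≡-Reasoning
    triangle : ∀ ((u , v , w) : Box n × Box n × Box n) →
      𝟙 (isInvTriple μ σ (u , v , w)) + χ μ σ u w ≡ χ μ σ u v + χ μ σ v w
    triangle (u , v , w) =
      inversion-triangle (proof (σ̂ μ σ v <? σ̂ μ σ u)) (proof (σ̂ μ σ w <? σ̂ μ σ v))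
                         (proof (σ̂ μ σ w <? σ̂ μ σ u))

  length-Inv :
    length (Inv μ σ) ≡ (length (invTriples μ σ) + sum (map (a μ) (Des μ σ))) + length (weakPairs μ σ)
  length-Inv = begin
    length (Inv μ σ)
      ≡⟨ trans (length-filter (isInv μ σ) (cartesianProduct (hatBoxes μ) (hatBoxes μ)))
               (∑-cartesianProduct (hatBoxes μ) (hatBoxes μ) _) ⟩
    ∑[ x ∈ hatBoxes μ ] ∑[ y ∈ hatBoxes μ ] 𝟙 (isInv μ σ (x , y))
      ≡⟨ ∑-cong-All (hatBoxes-All μ λ _ _ hj → ∑-cong-All (hatBoxes-All μ λ _ _ hj' → 𝟙-isInv hj hj')) ⟩
    ∑[ x ∈ hatBoxes μ ] ∑[ y ∈ hatBoxes μ ] (armPairs x y + (upArmPairs x y + weakBasePairs x y))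
      ≡⟨ ∑∑-+ armPairs _ ⟩
    ∑∑ armPairs + ∑[ x ∈ hatBoxes μ ] ∑[ y ∈ hatBoxes μ ] (upArmPairs x y + weakBasePairs x y)
      ≡⟨ cong (∑∑ armPairs +_) (∑∑-+ upArmPairs weakBasePairs) ⟩
    ∑∑ armPairs + (∑∑ upArmPairs + ∑∑ weakBasePairs)
      ≡⟨ sym (+-assoc (∑∑ armPairs) _ _) ⟩
    (∑∑ armPairs + ∑∑ upArmPairs) + ∑∑ weakBasePairs
      ≡⟨ cong₂ _+_ (sym (cong₂ _+_ ∑-triples-χ-uv ∑-triples-χ-vw)) ∑-weakBasePairs ⟩
    (∑ (triples μ σ) (λ (u , v , _) → χ μ σ u v) + ∑ (triples μ σ) (λ (_ , v , w) → χ μ σ v w))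
      + length (weakPairs μ σ)
      ≡⟨ cong (_+ length (weakPairs μ σ)) (sym ∑-triples-inversionTriangle) ⟩
    (length (invTriples μ σ) + ∑ (triples μ σ) (λ (u , _ , w) → χ μ σ u w)) + length (weakPairs μ σ)
      ≡⟨ cong (λ s → (length (invTriples μ σ) + s) + length (weakPairs μ σ)) ∑-triples-χ-uw ⟩
    (length (invTriples μ σ) + sum (map (a μ) (Des μ σ))) + length (weakPairs μ σ) ∎
    where
    open ≡-Reasoning
    armPairs upArmPairs weakBasePairs : Box n → Box n → ℕ
    armPairs x y = 𝟙 (isArmPair μ x y) * χ μ σ x y
    upArmPairs x y = 𝟙 (isArmPair μ (up y) x) * χ μ σ x y
    weakBasePairs x y = 𝟙 (isWeakBasePair μ x y)
    ∑∑ : (Box n → Box n → ℕ) → ℕ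
    ∑∑ f = ∑[ x ∈ hatBoxes μ ] ∑[ y ∈ hatBoxes μ ] f x y
    ∑∑-+ : ∀ f g → ∑[ x ∈ hatBoxes μ ] ∑[ y ∈ hatBoxes μ ] (f x y + g x y) ≡ ∑∑ f + ∑∑ g
    ∑∑-+ f g = trans (∑-cong (hatBoxes μ) λ x → ∑-+ (hatBoxes μ) (f x) (g x)) (∑-+ (hatBoxes μ) _ _)

  length-coinvTriples+invTriples :
    length (coinvTriples μ σ) + length (invTriples μ σ) ≡ sum (map (a μ) (dgBoxes μ))
  length-coinvTriples+invTriples = begin
    length (coinvTriples μ σ) + length (invTriples μ σ)
      ≡⟨ cong₂ _+_ (length-filter (not ∘ isInvTriple μ σ) (triples μ σ))
                   (length-filter (isInvTriple μ σ) (triples μ σ)) ⟩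
    ∑ (triples μ σ) (𝟙 ∘ not ∘ isInvTriple μ σ) + ∑ (triples μ σ) (𝟙 ∘ isInvTriple μ σ)
      ≡⟨ sym (∑-+ (triples μ σ) _ _) ⟩
    ∑ (triples μ σ) (λ t → 𝟙 (not (isInvTriple μ σ t)) + 𝟙 (isInvTriple μ σ t))
      ≡⟨ ∑-cong (triples μ σ) (𝟙-not+𝟙 ∘ isInvTriple μ σ) ⟩
    ∑[ _ ∈ triples μ σ ] 1
      ≡⟨ ∑-triples (λ _ → 1) ⟩
    ∑[ u ∈ dgBoxes μ ] ∑[ _ ∈ arm μ u ] 1
      ≡⟨ ∑-cong (dgBoxes μ) (λ u → trans (∑-const (arm μ u) 1) (*-identityʳ (a μ u))) ⟩
    sum (map (a μ) (dgBoxes μ)) ∎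
    where open ≡-Reasoning

open import Data.Integer using (+_; _-_)
import Data.Integer.Properties as ℤ

+[m+n]-+n≡+m : ∀ m n → + (m + n) - + n ≡ + m
+[m+n]-+n≡+m m n =
  trans (ℤ.[+m]-[+n]≡m⊖n (m + n) n) (trans (ℤ.⊖-≥ (m≤n+m n m)) (cong +_ (m+n∸n≡m m n)))

proposition3p4 : (n : ℕ) → 1 ≤ n → (μ : Fin n → ℕ) → (σ : Filling n μ) →
    (+ length (invTriples μ σ) ≡ inv μ σ) × (+ length (coinvTriples μ σ) ≡ coinv μ σ)
proposition3p4 n _ μ σ = invTriples≡inv , coinvTriples≡coinv
  where
  I = length (invTriples μ σ)
  C = length (coinvTriples μ σ)
  D = sum (map (a μ) (Des μ σ))
  W = length (weakPairs μ σ)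
  invTriples≡inv : + I ≡ inv μ σ
  invTriples≡inv = sym (begin
    (+ length (Inv μ σ) - + W) - + D    ≡⟨ cong (λ k → (+ k - + W) - + D) (length-Inv μ σ) ⟩
    (+ ((I + D) + W) - + W) - + D       ≡⟨ cong (_- + D) (+[m+n]-+n≡+m (I + D) W) ⟩
    + (I + D) - + D                     ≡⟨ +[m+n]-+n≡+m I D ⟩
    + I                                 ∎)
    where open ≡-Reasoning
  coinvTriples≡coinv : + C ≡ coinv μ σ
  coinvTriples≡coinv = sym (begin
    + sum (map (a μ) (dgBoxes μ)) - inv μ σ
      ≡⟨ cong₂ (λ k z → + k - z) (sym (length-coinvTriples+invTriples μ σ)) (sym invTriples≡inv) ⟩
    + (C + I) - + I
      ≡⟨ +[m+n]-+n≡+m C I ⟩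
    + C ∎)
    where open ≡-Reasoning
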